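{- Let $G \in \{\widehat{\mathtt{2Cs}},\widehat{\mathtt{2B}},\widehat{\mathtt{2Cn}}\}$, and let $m_0 = 72$ if $G = \widehat{\mathtt{2Cs}}$ and $m_0 = 36$ otherwise; write $m_0 = 2^k \cdot 9$ with $k \in \{2,3\}$. For a subgroup $H \subseteq G$ with $\det(H(m_0)) = (\mathbb{Z}/m_0\mathbb{Z})^\times$, we have $[H(m_0),H(m_0)] = [G(m_0),G(m_0)]$ if and only if $H(9) = \mathrm{GL}_2(\mathbb{Z}/9\mathbb{Z})$ and $H(2^k) \in \mathcal{M}(G(2^k))$.
   Context: $\mathtt{2Cs} = \{I\}$, $\mathtt{2B} = \langle \begin{psmallmatrix}1&1\\0&1\end{psmallmatrix}\rangle$, $\mathtt{2Cn} = \langle \begin{psmallmatrix}0&1\\1&1\end{psmallmatrix}\rangle \subseteq \mathrm{GL}_2(\mathbb{Z}/2\mathbb{Z})$; $\widehat{K}$ denotes the full preimage in $\mathrm{GL}_2(\widehat{\mathbb{Z}})$; $H(n)$ denotes the image of $H$ in $\mathrm{GL}_2(\mathbb{Z}/n\mathbb{Z})$. For $G \subseteq \mathrm{GL}_2(\mathbb{Z}/n\mathbb{Z})$, $\mathcal{M}(G) = \{H \subseteq G : \det(H) = \det(G),\ [H,H] = [G,G]\}$ (membership understood up to conjugacy). -}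

module Defs where

open import Data.Nat using (ℕ; zero; suc; _+_; _*_; _∸_; NonZero)
open import Data.Nat.DivMod using (_mod_)
open import Data.Nat.Divisibility using (_∣_)
open import Data.Fin using (Fin; toℕ)
open import Data.Product using (Σ; ∃; _×_; _,_)
open import Data.Sum using (_⊎_)
open import Relation.Binary.PropositionalEquality using (_≡_)
open import Function.Bundles using (_⇔_)

module _ {n : ℕ} .{{_ : NonZero n}} where
  infixl 6 _+ₙ_ _-ₙ_
  infixl 7 _*ₙ_

  _+ₙ_ : Fin n → Fin n → Fin n
  x +ₙ y = (toℕ x + toℕ y) mod n

  _-ₙ_ : Fin n → Fin n → Fin n
  x -ₙ y = (toℕ x + (n ∸ toℕ y)) mod n

  _*ₙ_ : Fin n → Fin n → Fin n
  x *ₙ y = (toℕ x * toℕ y) mod n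

  0ₙ 1ₙ : Fin n
  0ₙ = 0 mod n
  1ₙ = 1 mod n

  IsUnit : Fin n → Set
  IsUnit u = ∃ λ v → u *ₙ v ≡ 1ₙ

record Mat (n : ℕ) : Set where
  constructor mat
  field
    a b c d : Fin n

module _ {n : ℕ} .{{_ : NonZero n}} where
  infixl 7 _·_

  _·_ : Mat n → Mat n → Mat n
  mat a b c d · mat a' b' c' d' =
    mat (a *ₙ a' +ₙ b *ₙ c') (a *ₙ b' +ₙ b *ₙ d')
        (c *ₙ a' +ₙ d *ₙ c') (c *ₙ b' +ₙ d *ₙ d')

  I : Mat n
  I = mat 1ₙ 0ₙ 0ₙ 1ₙ

  det : Mat n → Fin n
  det (mat a b c d) = a *ₙ d -ₙ b *ₙ c

  InGL₂ : Mat n → Set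
  InGL₂ M = IsUnit (det M)

  MSet : Set₁
  MSet = Mat n → Set

  _⊆ₘ_ : MSet → MSet → Set
  S ⊆ₘ T = ∀ M → S M → T M

  _≐_ : MSet → MSet → Set
  S ≐ T = ∀ M → (S M ⇔ T M)

  detImage : MSet → Fin n → Set
  detImage S u = ∃ λ M → S M × det M ≡ u

  -- the commutator subgroup [S,S]: the subgroup generated by the
  -- commutators A B A⁻¹ B⁻¹ with A, B ∈ S (for a finite group, the set of
  -- finite products of commutators).
  data Comm (S : MSet) : MSet where
    comm-one  : Comm S I
    comm-step : ∀ {A A' B B' X} → S A → S B → A · A' ≡ I → B · B' ≡ I →
                Comm S X → Comm S (A · B · A' · B' · X)

  -- the conjugate g S g⁻¹ (where g · g' ≡ I)
  Conj : Mat n → Mat n → MSet → MSet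
  Conj g g' S M = ∃ λ Y → S Y × M ≡ g · Y · g'

  -- K ∈ 𝓜(G), up to conjugacy in GL₂(ℤ/nℤ): some GL₂-conjugate K' of K
  -- satisfies K' ⊆ G, det(K') = det(G), [K',K'] = [G,G].
  -- (K' is automatically a subgroup when K is.)
  In𝓜 : MSet → MSet → Set
  In𝓜 K G = Σ (Mat n) λ g → Σ (Mat n) λ g' → g · g' ≡ I ×
    (Conj g g' K ⊆ₘ G) ×
    (∀ u → detImage (Conj g g' K) u ⇔ detImage G u) ×
    (Comm (Conj g g' K) ≐ Comm G)

reduce : ∀ {n} (d : ℕ) .{{_ : NonZero d}} → Mat n → Mat d
reduce d (mat a b c d') = mat (toℕ a mod d) (toℕ b mod d) (toℕ c mod d) (toℕ d' mod d)

-- GL₂(ℤ̂) = lim GL₂(ℤ/nℤ): compatible systems of invertible matrices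

record GL₂Ẑ : Set where
  field
    at     : (n : ℕ) .{{_ : NonZero n}} → Mat n
    compat : (d n : ℕ) .{{_ : NonZero d}} .{{_ : NonZero n}} →
             d ∣ n → reduce d (at n) ≡ at d
    invert : (n : ℕ) .{{_ : NonZero n}} → InGL₂ (at n)
open GL₂Ẑ public

ZSet : Set₁
ZSet = GL₂Ẑ → Set

_⊆ᶻ_ : ZSet → ZSet → Set
H ⊆ᶻ K = ∀ A → H A → K A

_≈ᶻ_ : GL₂Ẑ → GL₂Ẑ → Set
A ≈ᶻ B = (n : ℕ) .{{_ : NonZero n}} → at A n ≡ at B n

record IsSubgroup (H : ZSet) : Set where
  field
    has-one : ∃ λ E → H E × ((n : ℕ) .{{_ : NonZero n}} → at E n ≡ I)
    has-mul : ∀ A B → H A → H B →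
              ∃ λ C → H C × ((n : ℕ) .{{_ : NonZero n}} → at C n ≡ at A n · at B n)
    has-inv : ∀ A → H A →
              ∃ λ B → H B × ((n : ℕ) .{{_ : NonZero n}} → at A n · at B n ≡ I)
    resp-≈  : ∀ A B → A ≈ᶻ B → H A → H B

img : ZSet → (n : ℕ) .{{_ : NonZero n}} → Mat n → Set
img H n M = ∃ λ A → H A × at A n ≡ M

data Label : Set where
  2Cs 2B 2Cn : Label

private
  o l : Fin 2
  o = Fin.zero where import Data.Fin as Fin
  l = Fin.suc Fin.zero where import Data.Fin as Fin

level2 : Label → Mat 2 → Set
level2 2Cs M = M ≡ mat l o o l
level2 2B  M = M ≡ mat l o o l ⊎ M ≡ mat l l o l
level2 2Cn M = M ≡ mat l o o l ⊎ (M ≡ mat o l l l ⊎ M ≡ mat l l l o)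

Ĝ : Label → ZSet
Ĝ t A = level2 t (at A 2)

-- 2^k and m₀ = 2^k · 9 (written as suc of a predecessor so that the
-- NonZero instances are found automatically for a variable label t)
pred2^k : Label → ℕ
pred2^k 2Cs = 7
pred2^k 2B  = 3
pred2^k 2Cn = 3

2^k : Label → ℕ
2^k t = suc (pred2^k t)

m₀ : Label → ℕ
m₀ t = suc (pred2^k t * 9 + 8)   -- = 2^k t * 9 : 72 for 2Cs, 36 otherwise

-- By the Chinese remainder theorem GL₂(ℤ/m₀) = GL₂(ℤ/2^k) × GL₂(ℤ/9). If S ⊆ G has images
-- D = diag(−1, 1), U(4) and L(4) modulo 9 (U, L upper and lower unipotent), then
-- [S(m₀), S(m₀)] ⊇ 1 × SL₂(ℤ/9): the commutators [D, U(4)] = U(1) and [D, L(4)] = L(1) lift to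
-- commutators in S(m₀) that are trivial modulo 2 because G(2) is abelian; their 28th powers are
-- then trivial modulo 2^k, since the kernel of reduction modulo 2 has exponent 4, and still U(1)
-- and L(1) modulo 9; these generate SL₂(ℤ/9). This applies to S = G, and to S = H once
-- H(9) = GL₂(ℤ/9). Then [H(m₀), H(m₀)] and [G(m₀), G(m₀)] agree on the 9-part, and the 2-parts
-- agree exactly when [H(2^k), H(2^k)] = [G(2^k), G(2^k)]. Conversely every element of GL₂(ℤ/9)
-- is the image of an element of H of the same determinant times an element of SL₂(ℤ/9). The
-- conjugation allowed in 𝓜 is harmless because elements of GL₂(ℤ/2^k) have order dividing 24.

module Submission where

open import Defs
open import Level using (0ℓ)
open import Data.Nat using (ℕ; zero; suc; _+_; _*_; _∸_; _%_; NonZero)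
open import Data.Nat.Properties as ℕ using ()
open import Data.Nat.DivMod using (_mod_; m%n<n; %-distribˡ-+; %-distribˡ-*; m<n⇒m%n≡m; n%n≡0; m*n%n≡0; m∣n⇒o%n%m≡o%m)
open import Data.Nat.Divisibility using (_∣_; divides; ∣-trans)
open import Data.Fin using (Fin; toℕ; _≟_; #_)
open import Data.Fin.Properties using (toℕ-injective; toℕ<n; toℕ-fromℕ<; all?; any?)
open import Data.Bool using (true; false)
open import Data.Product using (∃; _×_; _,_)
open import Data.Sum using (inj₁)
open import Function.Bundles using (_⇔_; mk⇔; Equivalence)
open import Algebra.Bundles using (Monoid; CommutativeRing)
open import Relation.Nullary.Decidable using (Dec; does; map′; _×-dec_; _⊎-dec_; _→-dec_; from-yes)
open import Relation.Binary.Definitions using (DecidableEquality)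
open import Relation.Binary.PropositionalEquality

-- The ring ℤ/nℤ

module _ {n : ℕ} .{{_ : NonZero n}} where

  toℕ-mod : ∀ m → toℕ (m mod n) ≡ m % n
  toℕ-mod m = toℕ-fromℕ< (m%n<n m n)

  %-≡⇒mod-≡ : ∀ {m m′} → m % n ≡ m′ % n → m mod n ≡ m′ mod n
  %-≡⇒mod-≡ {m} {m′} eq = toℕ-injective (trans (toℕ-mod m) (trans eq (sym (toℕ-mod m′))))

  toℕ-mod-id : ∀ x → toℕ x mod n ≡ x
  toℕ-mod-id x = toℕ-injective (trans (toℕ-mod (toℕ x)) (m<n⇒m%n≡m (toℕ<n x)))

  mod-+ : ∀ a b → (a + b) mod n ≡ a mod n +ₙ b mod n
  mod-+ a b = %-≡⇒mod-≡ (trans (%-distribˡ-+ a b n)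
    (sym (cong₂ (λ u v → (u + v) % n) (toℕ-mod a) (toℕ-mod b))))

  mod-* : ∀ a b → (a * b) mod n ≡ (a mod n) *ₙ (b mod n)
  mod-* a b = %-≡⇒mod-≡ (trans (%-distribˡ-* a b n)
    (sym (cong₂ (λ u v → (u * v) % n) (toℕ-mod a) (toℕ-mod b))))

  negₙ : Fin n → Fin n
  negₙ y = (n ∸ toℕ y) mod n

  -ₙ-+negₙ : ∀ x y → x -ₙ y ≡ x +ₙ negₙ y
  -ₙ-+negₙ x y = trans (mod-+ (toℕ x) (n ∸ toℕ y)) (cong (_+ₙ negₙ y) (toℕ-mod-id x))

  +ₙ-comm : ∀ x y → x +ₙ y ≡ y +ₙ x
  +ₙ-comm x y = cong (_mod n) (ℕ.+-comm (toℕ x) (toℕ y))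

  *ₙ-comm : ∀ x y → x *ₙ y ≡ y *ₙ x
  *ₙ-comm x y = cong (_mod n) (ℕ.*-comm (toℕ x) (toℕ y))

  +ₙ-assoc : ∀ x y z → (x +ₙ y) +ₙ z ≡ x +ₙ (y +ₙ z)
  +ₙ-assoc x y z = begin
    (x +ₙ y) +ₙ z                        ≡⟨ cong ((x +ₙ y) +ₙ_) (toℕ-mod-id z) ⟨
    (toℕ x + toℕ y) mod n +ₙ toℕ z mod n ≡⟨ mod-+ (toℕ x + toℕ y) (toℕ z) ⟨
    (toℕ x + toℕ y + toℕ z) mod n        ≡⟨ cong (_mod n) (ℕ.+-assoc (toℕ x) (toℕ y) (toℕ z)) ⟩
    (toℕ x + (toℕ y + toℕ z)) mod n      ≡⟨ mod-+ (toℕ x) (toℕ y + toℕ z) ⟩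
    toℕ x mod n +ₙ (y +ₙ z)              ≡⟨ cong (_+ₙ (y +ₙ z)) (toℕ-mod-id x) ⟩
    x +ₙ (y +ₙ z)                        ∎
    where open ≡-Reasoning

  *ₙ-assoc : ∀ x y z → (x *ₙ y) *ₙ z ≡ x *ₙ (y *ₙ z)
  *ₙ-assoc x y z = begin
    (x *ₙ y) *ₙ z                          ≡⟨ cong ((x *ₙ y) *ₙ_) (toℕ-mod-id z) ⟨
    (toℕ x * toℕ y) mod n *ₙ (toℕ z mod n) ≡⟨ mod-* (toℕ x * toℕ y) (toℕ z) ⟨
    (toℕ x * toℕ y * toℕ z) mod n          ≡⟨ cong (_mod n) (ℕ.*-assoc (toℕ x) (toℕ y) (toℕ z)) ⟩
    (toℕ x * (toℕ y * toℕ z)) mod n        ≡⟨ mod-* (toℕ x) (toℕ y * toℕ z) ⟩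
    (toℕ x mod n) *ₙ (y *ₙ z)              ≡⟨ cong (_*ₙ (y *ₙ z)) (toℕ-mod-id x) ⟩
    x *ₙ (y *ₙ z)                          ∎
    where open ≡-Reasoning

  *ₙ-distribˡ-+ₙ : ∀ x y z → x *ₙ (y +ₙ z) ≡ x *ₙ y +ₙ x *ₙ z
  *ₙ-distribˡ-+ₙ x y z = begin
    x *ₙ (y +ₙ z)                            ≡⟨ cong (_*ₙ (y +ₙ z)) (toℕ-mod-id x) ⟨
    (toℕ x mod n) *ₙ ((toℕ y + toℕ z) mod n) ≡⟨ mod-* (toℕ x) (toℕ y + toℕ z) ⟨
    (toℕ x * (toℕ y + toℕ z)) mod n          ≡⟨ cong (_mod n) (ℕ.*-distribˡ-+ (toℕ x) (toℕ y) (toℕ z)) ⟩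
    (toℕ x * toℕ y + toℕ x * toℕ z) mod n    ≡⟨ mod-+ (toℕ x * toℕ y) (toℕ x * toℕ z) ⟩
    x *ₙ y +ₙ x *ₙ z                         ∎
    where open ≡-Reasoning

  *ₙ-distribʳ-+ₙ : ∀ x y z → (y +ₙ z) *ₙ x ≡ y *ₙ x +ₙ z *ₙ x
  *ₙ-distribʳ-+ₙ x y z = trans (*ₙ-comm (y +ₙ z) x)
    (trans (*ₙ-distribˡ-+ₙ x y z) (cong₂ _+ₙ_ (*ₙ-comm x y) (*ₙ-comm x z)))

  +ₙ-identityˡ : ∀ x → 0ₙ +ₙ x ≡ x
  +ₙ-identityˡ x = trans (cong (0ₙ +ₙ_) (sym (toℕ-mod-id x))) (trans (sym (mod-+ 0 (toℕ x))) (toℕ-mod-id x))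

  +ₙ-identityʳ : ∀ x → x +ₙ 0ₙ ≡ x
  +ₙ-identityʳ x = trans (+ₙ-comm x 0ₙ) (+ₙ-identityˡ x)

  *ₙ-identityˡ : ∀ x → 1ₙ *ₙ x ≡ x
  *ₙ-identityˡ x = begin
    1ₙ *ₙ x                    ≡⟨ cong (1ₙ *ₙ_) (toℕ-mod-id x) ⟨
    (1 mod n) *ₙ (toℕ x mod n) ≡⟨ mod-* 1 (toℕ x) ⟨
    (1 * toℕ x) mod n          ≡⟨ cong (_mod n) (ℕ.*-identityˡ (toℕ x)) ⟩
    toℕ x mod n                ≡⟨ toℕ-mod-id x ⟩
    x                          ∎
    where open ≡-Reasoning

  *ₙ-identityʳ : ∀ x → x *ₙ 1ₙ ≡ x
  *ₙ-identityʳ x = trans (*ₙ-comm x 1ₙ) (*ₙ-identityˡ x)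

  1ₙ-unit : IsUnit 1ₙ
  1ₙ-unit = 1ₙ , *ₙ-identityˡ 1ₙ

  +ₙ-inverseʳ : ∀ y → y +ₙ negₙ y ≡ 0ₙ
  +ₙ-inverseʳ y = begin
    y +ₙ negₙ y                        ≡⟨ cong (_+ₙ negₙ y) (toℕ-mod-id y) ⟨
    toℕ y mod n +ₙ (n ∸ toℕ y) mod n   ≡⟨ mod-+ (toℕ y) (n ∸ toℕ y) ⟨
    (toℕ y + (n ∸ toℕ y)) mod n        ≡⟨ cong (_mod n) (ℕ.m+[n∸m]≡n (ℕ.<⇒≤ (toℕ<n y))) ⟩
    n mod n                            ≡⟨ %-≡⇒mod-≡ (trans (n%n≡0 n) (sym (m*n%n≡0 0 n))) ⟩ -- m*n%n≡0 0 n : 0 % n ≡ 0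
    0ₙ                                 ∎
    where open ≡-Reasoning

  +ₙ-inverseˡ : ∀ y → negₙ y +ₙ y ≡ 0ₙ
  +ₙ-inverseˡ y = trans (+ₙ-comm (negₙ y) y) (+ₙ-inverseʳ y)

  +ₙ-*ₙ-commutativeRing : CommutativeRing 0ℓ 0ℓ
  +ₙ-*ₙ-commutativeRing = record
    { Carrier = Fin n ; _≈_ = _≡_ ; _+_ = _+ₙ_ ; _*_ = _*ₙ_ ; -_ = negₙ ; 0# = 0ₙ ; 1# = 1ₙ
    ; isCommutativeRing = record
      { isRing = record
        { +-isAbelianGroup = record
          { isGroup = record
            { isMonoid = record
              { isSemigroup = record
                { isMagma = record { isEquivalence = isEquivalence ; ∙-cong = cong₂ _+ₙ_ }
                ; assoc = +ₙ-assoc }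
              ; identity = +ₙ-identityˡ , +ₙ-identityʳ }
            ; inverse = +ₙ-inverseˡ , +ₙ-inverseʳ
            ; ⁻¹-cong = cong negₙ }
          ; comm = +ₙ-comm }
        ; *-cong = cong₂ _*ₙ_
        ; *-assoc = *ₙ-assoc
        ; *-identity = *ₙ-identityˡ , *ₙ-identityʳ
        ; distrib = *ₙ-distribˡ-+ₙ , *ₙ-distribʳ-+ₙ }
      ; *-comm = *ₙ-comm } }

  open CommutativeRing +ₙ-*ₙ-commutativeRing using (+-group; commutativeSemiring)
  open import Algebra.Properties.Group +-group using (∙-cancelʳ)
  open import Algebra.Solver.Ring.NaturalCoefficients.Default commutativeSemiring

  -ₙ-+ₙ-cancel : ∀ x y → (x -ₙ y) +ₙ y ≡ x
  -ₙ-+ₙ-cancel x y = begin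
    (x -ₙ y) +ₙ y       ≡⟨ cong (_+ₙ y) (-ₙ-+negₙ x y) ⟩
    x +ₙ negₙ y +ₙ y    ≡⟨ +ₙ-assoc x (negₙ y) y ⟩
    x +ₙ (negₙ y +ₙ y)  ≡⟨ cong (x +ₙ_) (+ₙ-inverseˡ y) ⟩
    x +ₙ 0ₙ             ≡⟨ +ₙ-identityʳ x ⟩
    x                   ∎
    where open ≡-Reasoning

  +ₙ⇒-ₙ : ∀ {x y z} → z +ₙ y ≡ x → x -ₙ y ≡ z
  +ₙ⇒-ₙ {x} {y} {z} eq = ∙-cancelʳ y (x -ₙ y) z (trans (-ₙ-+ₙ-cancel x y) (sym eq))

  -ₙ-cross : ∀ {x y z w} → x +ₙ w ≡ z +ₙ y → x -ₙ y ≡ z -ₙ w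
  -ₙ-cross {x} {y} {z} {w} eq = +ₙ⇒-ₙ (∙-cancelʳ w _ x (begin
    (z -ₙ w) +ₙ y +ₙ w   ≡⟨ solve 3 (λ u y w → u :+ y :+ w := u :+ w :+ y) refl (z -ₙ w) y w ⟩
    (z -ₙ w) +ₙ w +ₙ y   ≡⟨ cong (_+ₙ y) (-ₙ-+ₙ-cancel z w) ⟩
    z +ₙ y               ≡⟨ eq ⟨
    x +ₙ w               ∎))
    where open ≡-Reasoning

  -- Writing x = (x − y) + y and z = (z − w) + w turns the claim into a semiring identity.
  -ₙ-*ₙ-distrib : ∀ x y z w → (x -ₙ y) *ₙ (z -ₙ w) ≡ (x *ₙ z +ₙ y *ₙ w) -ₙ (x *ₙ w +ₙ y *ₙ z)
  -ₙ-*ₙ-distrib x y z w = sym (+ₙ⇒-ₙ (subst₂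
    (λ x′ z′ → (x -ₙ y) *ₙ (z -ₙ w) +ₙ (x′ *ₙ w +ₙ y *ₙ z′) ≡ x′ *ₙ z′ +ₙ y *ₙ w)
    (-ₙ-+ₙ-cancel x y) (-ₙ-+ₙ-cancel z w)
    (solve 4 (λ u v y w → u :* v :+ ((u :+ y) :* w :+ y :* (v :+ w)) := (u :+ y) :* (v :+ w) :+ y :* w)
      refl (x -ₙ y) (z -ₙ w) y w)))

-- 2 × 2 matrices

mat-≡ : ∀ {n} {a b c d a′ b′ c′ d′ : Fin n} →
        a ≡ a′ → b ≡ b′ → c ≡ c′ → d ≡ d′ → mat a b c d ≡ mat a′ b′ c′ d′
mat-≡ refl refl refl refl = refl

module _ {n : ℕ} .{{_ : NonZero n}} where
  open CommutativeRing (+ₙ-*ₙ-commutativeRing {n}) using (commutativeSemiring; ring; zeroˡ; zeroʳ)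
  open import Algebra.Solver.Ring.NaturalCoefficients.Default commutativeSemiring
  open import Algebra.Properties.Ring ring using (-‿distribˡ-*; -‿distribʳ-*)

  ·-assoc : (A B C : Mat n) → (A · B) · C ≡ A · (B · C)
  ·-assoc (mat a b c d) (mat a′ b′ c′ d′) (mat a″ b″ c″ d″) =
    mat-≡ (entry a b a″ c″) (entry a b b″ d″) (entry c d a″ c″) (entry c d b″ d″)
    where
    entry : ∀ p q r s → (p *ₙ a′ +ₙ q *ₙ c′) *ₙ r +ₙ (p *ₙ b′ +ₙ q *ₙ d′) *ₙ s
                      ≡ p *ₙ (a′ *ₙ r +ₙ b′ *ₙ s) +ₙ q *ₙ (c′ *ₙ r +ₙ d′ *ₙ s)
    entry = solve 8 (λ a′ b′ c′ d′ p q r s →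
      (p :* a′ :+ q :* c′) :* r :+ (p :* b′ :+ q :* d′) :* s
        := p :* (a′ :* r :+ b′ :* s) :+ q :* (c′ :* r :+ d′ :* s)) refl a′ b′ c′ d′

  ·-identityˡ : (A : Mat n) → I · A ≡ A
  ·-identityˡ (mat a b c d) = mat-≡ (entry a c) (entry b d) (entry′ a c) (entry′ b d)
    where
    entry : ∀ x y → 1ₙ *ₙ x +ₙ 0ₙ *ₙ y ≡ x
    entry = solve 2 (λ x y → con 1 :* x :+ con 0 :* y := x) refl
    entry′ : ∀ x y → 0ₙ *ₙ x +ₙ 1ₙ *ₙ y ≡ y
    entry′ = solve 2 (λ x y → con 0 :* x :+ con 1 :* y := y) refl

  ·-identityʳ : (A : Mat n) → A · I ≡ A
  ·-identityʳ (mat a b c d) = mat-≡ (entry a b) (entry′ a b) (entry c d) (entry′ c d)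
    where
    entry : ∀ x y → x *ₙ 1ₙ +ₙ y *ₙ 0ₙ ≡ x
    entry = solve 2 (λ x y → x :* con 1 :+ y :* con 0 := x) refl
    entry′ : ∀ x y → x *ₙ 0ₙ +ₙ y *ₙ 1ₙ ≡ y
    entry′ = solve 2 (λ x y → x :* con 0 :+ y :* con 1 := y) refl

  ·-monoid : Monoid 0ℓ 0ℓ
  ·-monoid = record
    { Carrier = Mat n ; _≈_ = _≡_ ; _∙_ = _·_ ; ε = I
    ; isMonoid = record
      { isSemigroup = record
        { isMagma = record { isEquivalence = isEquivalence ; ∙-cong = cong₂ _·_ }
        ; assoc = ·-assoc }
      ; identity = ·-identityˡ , ·-identityʳ } }

  -- Both determinants are differences; comparing cross sums keeps every step a semiring identity.
  det-· : (A B : Mat n) → det (A · B) ≡ det A *ₙ det B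
  det-· (mat a b c d) (mat a′ b′ c′ d′) = begin
    P -ₙ Q                                              ≡⟨ -ₙ-cross {x = P} {y = Q} cross-sums ⟩
    (ad *ₙ a′d′ +ₙ bc *ₙ b′c′) -ₙ (ad *ₙ b′c′ +ₙ bc *ₙ a′d′) ≡⟨ -ₙ-*ₙ-distrib ad bc a′d′ b′c′ ⟨
    (ad -ₙ bc) *ₙ (a′d′ -ₙ b′c′)                        ∎
    where
    open ≡-Reasoning
    P = (a *ₙ a′ +ₙ b *ₙ c′) *ₙ (c *ₙ b′ +ₙ d *ₙ d′)
    Q = (a *ₙ b′ +ₙ b *ₙ d′) *ₙ (c *ₙ a′ +ₙ d *ₙ c′)
    ad = a *ₙ d
    bc = b *ₙ c
    a′d′ = a′ *ₙ d′
    b′c′ = b′ *ₙ c′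
    cross-sums : P +ₙ (ad *ₙ b′c′ +ₙ bc *ₙ a′d′) ≡ (ad *ₙ a′d′ +ₙ bc *ₙ b′c′) +ₙ Q
    cross-sums = solve 8 (λ a b c d a′ b′ c′ d′ →
      (a :* a′ :+ b :* c′) :* (c :* b′ :+ d :* d′) :+ ((a :* d) :* (b′ :* c′) :+ (b :* c) :* (a′ :* d′))
        := (a :* d) :* (a′ :* d′) :+ (b :* c) :* (b′ :* c′) :+ (a :* b′ :+ b :* d′) :* (c :* a′ :+ d :* c′))
      refl a b c d a′ b′ c′ d′

  det-I : det (I {n}) ≡ 1ₙ
  det-I = +ₙ⇒-ₙ {x = 1ₙ *ₙ 1ₙ} {y = 0ₙ *ₙ 0ₙ} (solve 0 (con 1 :+ con 0 :* con 0 := con 1 :* con 1) refl)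

  det-inverse : ∀ (A B : Mat n) → A · B ≡ I → det A *ₙ det B ≡ 1ₙ
  det-inverse A B AB≡I = trans (sym (det-· A B)) (trans (cong det AB≡I) det-I)

  adjugate : Fin n → Mat n → Mat n
  adjugate v (mat a b c d) = mat (v *ₙ d) (v *ₙ negₙ b) (v *ₙ negₙ c) (v *ₙ a)

  private
    det-mat : ∀ a b c d → det (mat a b c d) ≡ a *ₙ d +ₙ b *ₙ negₙ c
    det-mat a b c d = trans (-ₙ-+negₙ (a *ₙ d) (b *ₙ c)) (cong (a *ₙ d +ₙ_) (-‿distribʳ-* b c))

    det-mat′ : ∀ a b c d → det (mat a b c d) ≡ a *ₙ d +ₙ negₙ b *ₙ c
    det-mat′ a b c d = trans (-ₙ-+negₙ (a *ₙ d) (b *ₙ c)) (cong (a *ₙ d +ₙ_) (-‿distribˡ-* b c))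

    annihilate : ∀ v x y → v *ₙ ((x +ₙ negₙ x) *ₙ y) ≡ 0ₙ
    annihilate v x y = trans (cong (λ z → v *ₙ (z *ₙ y)) (+ₙ-inverseʳ x))
                             (trans (cong (v *ₙ_) (zeroˡ y)) (zeroʳ v))

  ·-adjugate : ∀ v A → v *ₙ det A ≡ 1ₙ → A · adjugate v A ≡ I
  ·-adjugate v (mat a b c d) v·det≡1 = mat-≡
    (trans (solve 5 (λ v a b nc d → a :* (v :* d) :+ b :* (v :* nc) := v :* (a :* d :+ b :* nc))
             refl v a b (negₙ c) d) (trans (cong (v *ₙ_) (sym (det-mat a b c d))) v·det≡1))
    (trans (solve 4 (λ v a b nb → a :* (v :* nb) :+ b :* (v :* a) := v :* ((b :+ nb) :* a))
             refl v a b (negₙ b)) (annihilate v b a))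
    (trans (solve 4 (λ v c d nc → c :* (v :* d) :+ d :* (v :* nc) := v :* ((c :+ nc) :* d))
             refl v c d (negₙ c)) (annihilate v c d))
    (trans (solve 5 (λ v a nb c d → c :* (v :* nb) :+ d :* (v :* a) := v :* (a :* d :+ nb :* c))
             refl v a (negₙ b) c d) (trans (cong (v *ₙ_) (sym (det-mat′ a b c d))) v·det≡1))

  adjugate-· : ∀ v A → v *ₙ det A ≡ 1ₙ → adjugate v A · A ≡ I
  adjugate-· v (mat a b c d) v·det≡1 = mat-≡
    (trans (solve 5 (λ v a nb c d → (v :* d) :* a :+ (v :* nb) :* c := v :* (a :* d :+ nb :* c))
             refl v a (negₙ b) c d) (trans (cong (v *ₙ_) (sym (det-mat′ a b c d))) v·det≡1))
    (trans (solve 4 (λ v b nb d → (v :* d) :* b :+ (v :* nb) :* d := v :* ((b :+ nb) :* d))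
             refl v b (negₙ b) d) (annihilate v b d))
    (trans (solve 4 (λ v c nc a → (v :* nc) :* a :+ (v :* a) :* c := v :* ((c :+ nc) :* a))
             refl v c (negₙ c) a) (annihilate v c a))
    (trans (solve 5 (λ v a b nc d → (v :* nc) :* b :+ (v :* a) :* d := v :* (a :* d :+ b :* nc))
             refl v a b (negₙ c) d) (trans (cong (v *ₙ_) (sym (det-mat a b c d))) v·det≡1))
  -- Opaque so that the adjugate formula is never unfolded while unifying matrix expressions.
  opaque
    InGL₂⇒inverse : ∀ A → InGL₂ A → ∃ λ B → A · B ≡ I
    InGL₂⇒inverse A (v , det·v≡1) = adjugate v A , ·-adjugate v A (trans (*ₙ-comm v (det A)) det·v≡1)

  ·-inverseʳ⇒ˡ : ∀ (A B : Mat n) → A · B ≡ I → B · A ≡ I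
  ·-inverseʳ⇒ˡ A B AB≡I = subst (λ C → C · A ≡ I) (sym B≡C) CA≡I
    where
    v = det B
    C = adjugate v A
    CA≡I : C · A ≡ I
    CA≡I = adjugate-· v A (trans (*ₙ-comm v (det A)) (det-inverse A B AB≡I))
    B≡C : B ≡ C
    B≡C = begin
      B           ≡⟨ ·-identityˡ B ⟨
      I · B       ≡⟨ cong (_· B) CA≡I ⟨
      (C · A) · B ≡⟨ ·-assoc C A B ⟩
      C · (A · B) ≡⟨ cong (C ·_) AB≡I ⟩
      C · I       ≡⟨ ·-identityʳ C ⟩
      C           ∎
      where open ≡-Reasoning

  inverse-cancelˡ : ∀ (A A′ X : Mat n) → A · A′ ≡ I → A · (A′ · X) ≡ X
  inverse-cancelˡ A A′ X AA′≡I = trans (sym (·-assoc A A′ X)) (trans (cong (_· X) AA′≡I) (·-identityˡ X))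

  inverse-unique : ∀ (A B B′ : Mat n) → A · B ≡ I → A · B′ ≡ I → B ≡ B′
  inverse-unique A B B′ AB≡I AB′≡I = begin
    B            ≡⟨ ·-identityʳ B ⟨
    B · I        ≡⟨ cong (B ·_) AB′≡I ⟨
    B · (A · B′) ≡⟨ ·-assoc B A B′ ⟨
    (B · A) · B′ ≡⟨ cong (_· B′) (·-inverseʳ⇒ˡ A B AB≡I) ⟩
    I · B′       ≡⟨ ·-identityˡ B′ ⟩
    B′           ∎
    where open ≡-Reasoning

module _ {n : ℕ} .{{_ : NonZero n}} where
  open CommutativeRing (+ₙ-*ₙ-commutativeRing {n}) using (commutativeSemiring; ring)
  open import Algebra.Solver.Ring.NaturalCoefficients.Default commutativeSemiring
  open import Algebra.Properties.Ring ring using (-1*x≈-x; -‿involutive)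
  open import Algebra.Solver.Monoid (·-monoid {n}) using (_⊕_; _⊜_) renaming (solve to solveₘ)

  det≡1⇒InGL₂ : ∀ (A : Mat n) → det A ≡ 1ₙ → InGL₂ A
  det≡1⇒InGL₂ A det≡1 = subst IsUnit (sym det≡1) 1ₙ-unit

  det≡1-inverse : ∀ (A B : Mat n) → det A ≡ 1ₙ → A · B ≡ I → det B ≡ 1ₙ
  det≡1-inverse A B det≡1 AB≡I =
    trans (sym (*ₙ-identityˡ (det B))) (trans (cong (_*ₙ det B) (sym det≡1)) (det-inverse A B AB≡I))

  det≡1-· : ∀ (A B : Mat n) → det A ≡ 1ₙ → det B ≡ 1ₙ → det (A · B) ≡ 1ₙ
  det≡1-· A B detA≡1 detB≡1 = trans (det-· A B) (trans (cong₂ _*ₙ_ detA≡1 detB≡1) (*ₙ-identityˡ 1ₙ))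

  commuting⇒commutator≡I : ∀ (A B A′ B′ : Mat n) → A · B ≡ B · A → A · A′ ≡ I → B · B′ ≡ I →
                           A · B · A′ · B′ ≡ I
  commuting⇒commutator≡I A B A′ B′ AB≡BA AA′≡I BB′≡I = begin
    A · B · A′ · B′       ≡⟨ cong (λ X → X · A′ · B′) AB≡BA ⟩
    B · A · A′ · B′       ≡⟨ solveₘ 4 (λ B A A′ B′ → ((B ⊕ A) ⊕ A′) ⊕ B′ ⊜ (B ⊕ (A ⊕ A′)) ⊕ B′)
                                     refl B A A′ B′ ⟩
    B · (A · A′) · B′     ≡⟨ cong (λ X → B · X · B′) AA′≡I ⟩
    B · I · B′            ≡⟨ cong (_· B′) (·-identityʳ B) ⟩
    B · B′                ≡⟨ BB′≡I ⟩
    I                     ∎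
    where open ≡-Reasoning

  upper lower : Fin n → Mat n
  upper x = mat 1ₙ x 0ₙ 1ₙ
  lower x = mat 1ₙ 0ₙ x 1ₙ

  det-upper : ∀ x → det (upper x) ≡ 1ₙ
  det-upper x = +ₙ⇒-ₙ {x = 1ₙ *ₙ 1ₙ} {y = x *ₙ 0ₙ} (solve 1 (λ x → con 1 :+ x :* con 0 := con 1 :* con 1) refl x)

  det-lower : ∀ x → det (lower x) ≡ 1ₙ
  det-lower x = +ₙ⇒-ₙ {x = 1ₙ *ₙ 1ₙ} {y = 0ₙ *ₙ x} (solve 1 (λ x → con 1 :+ con 0 :* x := con 1 :* con 1) refl x)

  unipotentWord : Fin n × Fin n × Fin n × Fin n → Mat n
  unipotentWord (w , x , y , z) = lower w · upper x · lower y · upper z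

  reflection : Mat n
  reflection = mat (negₙ 1ₙ) 0ₙ 0ₙ 1ₙ

  reflection-involutive : reflection · reflection ≡ I
  reflection-involutive = mat-≡
    (trans (solve 1 (λ m → m :* m :+ con 0 :* con 0 := m :* m) refl (negₙ 1ₙ))
           (trans (-1*x≈-x (negₙ 1ₙ)) (-‿involutive 1ₙ)))
    (solve 1 (λ m → m :* con 0 :+ con 0 :* con 1 := con 0) refl (negₙ 1ₙ))
    (solve 1 (λ m → con 0 :* m :+ con 1 :* con 0 := con 0) refl (negₙ 1ₙ))
    (solve 0 (con 0 :* con 0 :+ con 1 :* con 1 := con 1) refl)

-- Reduction modulo a divisor

red : ∀ {n} (d : ℕ) .{{_ : NonZero d}} → Fin n → Fin d
red d x = toℕ x mod d

module _ {n d : ℕ} .{{_ : NonZero n}} .{{_ : NonZero d}} (d∣n : d ∣ n) where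

  red-mod : ∀ m → red d (m mod n) ≡ m mod d
  red-mod m = %-≡⇒mod-≡ (trans (cong (_% d) (toℕ-mod m)) (m∣n⇒o%n%m≡o%m d n m d∣n))

  red-+ₙ : ∀ (x y : Fin n) → red d (x +ₙ y) ≡ red d x +ₙ red d y
  red-+ₙ x y = trans (red-mod (toℕ x + toℕ y)) (mod-+ (toℕ x) (toℕ y))

  red-*ₙ : ∀ (x y : Fin n) → red d (x *ₙ y) ≡ red d x *ₙ red d y
  red-*ₙ x y = trans (red-mod (toℕ x * toℕ y)) (mod-* (toℕ x) (toℕ y))

  red--ₙ : ∀ (x y : Fin n) → red d (x -ₙ y) ≡ red d x -ₙ red d y
  red--ₙ x y = sym (+ₙ⇒-ₙ (trans (sym (red-+ₙ (x -ₙ y) y)) (cong (red d) (-ₙ-+ₙ-cancel x y))))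

  red-1ₙ : red d (1ₙ {n}) ≡ 1ₙ
  red-1ₙ = red-mod 1

  red-0ₙ : red d (0ₙ {n}) ≡ 0ₙ
  red-0ₙ = red-mod 0

  red-negₙ : ∀ (x : Fin n) → red d (negₙ x) ≡ negₙ (red d x)
  red-negₙ x = begin
    red d (negₙ x)            ≡⟨ cong (red d) (+ₙ-identityˡ (negₙ x)) ⟨
    red d (0ₙ +ₙ negₙ x)      ≡⟨ cong (red d) (-ₙ-+negₙ 0ₙ x) ⟨
    red d (0ₙ -ₙ x)           ≡⟨ red--ₙ 0ₙ x ⟩
    red d 0ₙ -ₙ red d x       ≡⟨ cong (_-ₙ red d x) red-0ₙ ⟩
    0ₙ -ₙ red d x             ≡⟨ -ₙ-+negₙ 0ₙ (red d x) ⟩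
    0ₙ +ₙ negₙ (red d x)      ≡⟨ +ₙ-identityˡ (negₙ (red d x)) ⟩
    negₙ (red d x)            ∎
    where open ≡-Reasoning

  reduce-· : (A B : Mat n) → reduce d (A · B) ≡ reduce d A · reduce d B
  reduce-· (mat a b c x) (mat a′ b′ c′ x′) =
    mat-≡ (entry a b a′ c′) (entry a b b′ x′) (entry c x a′ c′) (entry c x b′ x′)
    where
    entry : ∀ (p q r s : Fin n) → red d (p *ₙ r +ₙ q *ₙ s) ≡ red d p *ₙ red d r +ₙ red d q *ₙ red d s
    entry p q r s = trans (red-+ₙ (p *ₙ r) (q *ₙ s)) (cong₂ _+ₙ_ (red-*ₙ p r) (red-*ₙ q s))

  reduce-I : reduce d (I {n}) ≡ I
  reduce-I = mat-≡ red-1ₙ red-0ₙ red-0ₙ red-1ₙ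

  det-reduce : (A : Mat n) → det (reduce d A) ≡ red d (det A)
  det-reduce (mat a b c x) = sym (trans (red--ₙ (a *ₙ x) (b *ₙ c)) (cong₂ _-ₙ_ (red-*ₙ a x) (red-*ₙ b c)))

  reduce-inverse : ∀ (A B : Mat n) → A · B ≡ I → reduce d A · reduce d B ≡ I
  reduce-inverse A B AB≡I = trans (sym (reduce-· A B)) (trans (cong (reduce d) AB≡I) reduce-I)

  reduce-inverse-unique : ∀ (A A′ : Mat n) {a a′ : Mat d} →
                          reduce d A ≡ a → A · A′ ≡ I → a · a′ ≡ I → reduce d A′ ≡ a′
  reduce-inverse-unique A A′ {a} {a′} refl AA′≡I aa′≡I =
    inverse-unique (reduce d A) (reduce d A′) a′ (reduce-inverse A A′ AA′≡I) aa′≡I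

  det≡1-reduce : ∀ (A : Mat n) → det A ≡ 1ₙ → det (reduce d A) ≡ 1ₙ
  det≡1-reduce A detA≡1 = trans (det-reduce A) (trans (cong (red d) detA≡1) red-1ₙ)

  reduce-upper : ∀ m → reduce d (upper {n} (m mod n)) ≡ upper (m mod d)
  reduce-upper m = mat-≡ red-1ₙ (red-mod m) red-0ₙ red-1ₙ

  reduce-lower : ∀ m → reduce d (lower {n} (m mod n)) ≡ lower (m mod d)
  reduce-lower m = mat-≡ red-1ₙ red-0ₙ (red-mod m) red-1ₙ

  reduce-reflection : reduce d (reflection {n}) ≡ reflection
  reduce-reflection = mat-≡ (trans (red-negₙ 1ₙ) (cong negₙ red-1ₙ)) red-0ₙ red-0ₙ red-1ₙ

red-red : ∀ {n e d} .{{_ : NonZero e}} .{{_ : NonZero d}} → d ∣ e → (x : Fin n) → red d (red e x) ≡ red d x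
red-red d∣e x = red-mod d∣e (toℕ x)

reduce-reduce : ∀ {n e d} .{{_ : NonZero e}} .{{_ : NonZero d}} → d ∣ e → (A : Mat n) → reduce d (reduce e A) ≡ reduce d A
reduce-reduce d∣e (mat a b c x) = mat-≡ (red-red d∣e a) (red-red d∣e b) (red-red d∣e c) (red-red d∣e x)

-- Powers and commutator subgroups

module _ {n : ℕ} .{{_ : NonZero n}} where

  -- Opaque so that powers of concrete matrices are not unfolded during unification;
  -- the finite computations below unfold it explicitly.
  opaque
    pow : Mat n → ℕ → Mat n
    pow X zero    = I
    pow X (suc k) = X · pow X k

    pow-zero : ∀ X → pow X zero ≡ I
    pow-zero X = refl

    pow-suc : ∀ X k → pow X (suc k) ≡ X · pow X k
    pow-suc X k = refl

  pow-+ : ∀ X j k → pow X (j + k) ≡ pow X j · pow X k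
  pow-+ X zero    k = sym (trans (cong (_· pow X k) (pow-zero X)) (·-identityˡ (pow X k)))
  pow-+ X (suc j) k = begin
    pow X (suc j + k)          ≡⟨ pow-suc X (j + k) ⟩
    X · pow X (j + k)          ≡⟨ cong (X ·_) (pow-+ X j k) ⟩
    X · (pow X j · pow X k)    ≡⟨ ·-assoc X (pow X j) (pow X k) ⟨
    X · pow X j · pow X k      ≡⟨ cong (_· pow X k) (pow-suc X j) ⟨
    pow X (suc j) · pow X k    ∎
    where open ≡-Reasoning

  pow-I : ∀ k → pow I k ≡ I
  pow-I zero    = pow-zero I
  pow-I (suc k) = trans (pow-suc I k) (trans (·-identityˡ (pow I k)) (pow-I k))

  pow-*-≡I : ∀ X p → pow X p ≡ I → ∀ j → pow X (j * p) ≡ I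
  pow-*-≡I X p Xᵖ≡I zero    = pow-zero X
  pow-*-≡I X p Xᵖ≡I (suc j) = begin
    pow X (p + j * p)         ≡⟨ pow-+ X p (j * p) ⟩
    pow X p · pow X (j * p)   ≡⟨ cong₂ _·_ Xᵖ≡I (pow-*-≡I X p Xᵖ≡I j) ⟩
    I · I                     ≡⟨ ·-identityˡ I ⟩
    I                         ∎
    where open ≡-Reasoning

  pow-sucʳ : ∀ X k → pow X (suc k) ≡ pow X k · X
  pow-sucʳ X k = begin
    pow X (suc k)       ≡⟨ cong (pow X) (ℕ.+-comm 1 k) ⟩
    pow X (k + 1)       ≡⟨ pow-+ X k 1 ⟩
    pow X k · pow X 1   ≡⟨ cong (pow X k ·_) (trans (pow-suc X 0) (trans (cong (X ·_) (pow-zero X)) (·-identityʳ X))) ⟩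
    pow X k · X         ∎
    where open ≡-Reasoning

  Comm-mono : ∀ {S T : MSet {n}} → S ⊆ₘ T → Comm S ⊆ₘ Comm T
  Comm-mono S⊆T _ comm-one = comm-one
  Comm-mono S⊆T _ (comm-step sA sB hA hB cX) = comm-step (S⊆T _ sA) (S⊆T _ sB) hA hB (Comm-mono S⊆T _ cX)

  Comm-· : ∀ {S : MSet {n}} {X Y} → Comm S X → Comm S Y → Comm S (X · Y)
  Comm-· {S} {Y = Y} comm-one cY = subst (Comm S) (sym (·-identityˡ Y)) cY
  Comm-· {S} {Y = Y} (comm-step {A} {A′} {B} {B′} {X} sA sB hA hB cX) cY =
    subst (Comm S) (sym (·-assoc (A · B · A′ · B′) X Y)) (comm-step sA sB hA hB (Comm-· cX cY))

  Comm-pow : ∀ {S : MSet {n}} {X} → Comm S X → ∀ k → Comm S (pow X k)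
  Comm-pow {S} {X} cX zero    = subst (Comm S) (sym (pow-zero X)) comm-one
  Comm-pow {S} {X} cX (suc k) = subst (Comm S) (sym (pow-suc X k)) (Comm-· cX (Comm-pow cX k))

  Comm-commutator : ∀ {S : MSet {n}} {A A′ B B′} → S A → S B → A · A′ ≡ I → B · B′ ≡ I →
                    Comm S (A · B · A′ · B′)
  Comm-commutator {S} {A} {A′} {B} {B′} sA sB hA hB =
    subst (Comm S) (·-identityʳ (A · B · A′ · B′)) (comm-step sA sB hA hB comm-one)

  det-Comm : ∀ {S : MSet {n}} X → Comm S X → det X ≡ 1ₙ
  det-Comm _ comm-one = det-I
  det-Comm _ (comm-step {A} {A′} {B} {B′} {X} sA sB hA hB cX) = begin
    det (A · B · A′ · B′ · X)                    ≡⟨ det-· (A · B · A′ · B′) X ⟩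
    det (A · B · A′ · B′) *ₙ det X               ≡⟨ cong₂ _*ₙ_ det-commutator (det-Comm X cX) ⟩
    (det A *ₙ det A′) *ₙ (det B *ₙ det B′) *ₙ 1ₙ ≡⟨ cong₂ (λ u v → u *ₙ v *ₙ 1ₙ) (det-inverse A A′ hA)
                                                                              (det-inverse B B′ hB) ⟩
    1ₙ *ₙ 1ₙ *ₙ 1ₙ                               ≡⟨ trans (*ₙ-identityʳ _) (*ₙ-identityʳ _) ⟩
    1ₙ                                           ∎
    where
    open ≡-Reasoning
    open CommutativeRing (+ₙ-*ₙ-commutativeRing {n}) using (commutativeSemiring)
    open import Algebra.Solver.Ring.NaturalCoefficients.Default commutativeSemiring
    det-commutator : det (A · B · A′ · B′) ≡ (det A *ₙ det A′) *ₙ (det B *ₙ det B′)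
    det-commutator = begin
      det (A · B · A′ · B′)                   ≡⟨ det-· (A · B · A′) B′ ⟩
      det (A · B · A′) *ₙ det B′              ≡⟨ cong (_*ₙ det B′) (det-· (A · B) A′) ⟩
      det (A · B) *ₙ det A′ *ₙ det B′         ≡⟨ cong (λ u → u *ₙ det A′ *ₙ det B′) (det-· A B) ⟩
      det A *ₙ det B *ₙ det A′ *ₙ det B′      ≡⟨ solve 4 (λ a b a′ b′ → a :* b :* a′ :* b′ := (a :* a′) :* (b :* b′))
                                                         refl (det A) (det B) (det A′) (det B′) ⟩
      (det A *ₙ det A′) *ₙ (det B *ₙ det B′)  ∎

  module _ {H : ZSet} (H-subgroup : IsSubgroup H) where
    open IsSubgroup H-subgroup

    img-· : ∀ {A B} → img H n A → img H n B → img H n (A · B)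
    img-· (P , hP , refl) (Q , hQ , refl) with has-mul P Q hP hQ
    ... | C , hC , C≡PQ = C , hC , C≡PQ n

    img-inverse : ∀ {A A′} → img H n A → A · A′ ≡ I → img H n A′
    img-inverse {A′ = A′} (P , hP , refl) hA with has-inv P hP
    ... | P′ , hP′ , PP′≡I = P′ , hP′ , inverse-unique (at P n) (at P′ n) A′ (PP′≡I n) hA

    Comm-img⊆img : Comm (img H n) ⊆ₘ img H n
    Comm-img⊆img _ comm-one with has-one
    ... | E , hE , E≡I = E , hE , E≡I n
    Comm-img⊆img _ (comm-step sA sB hA hB cX) =
      img-· (img-· (img-· (img-· sA sB) (img-inverse sA hA)) (img-inverse sB hB)) (Comm-img⊆img _ cX)

module _ {n d : ℕ} .{{_ : NonZero n}} .{{_ : NonZero d}} (d∣n : d ∣ n) where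

  reduce-pow : ∀ (X : Mat n) k → reduce d (pow X k) ≡ pow (reduce d X) k
  reduce-pow X zero    = trans (cong (reduce d) (pow-zero X)) (trans (reduce-I d∣n) (sym (pow-zero (reduce d X))))
  reduce-pow X (suc k) = begin
    reduce d (pow X (suc k))                ≡⟨ cong (reduce d) (pow-suc X k) ⟩
    reduce d (X · pow X k)                  ≡⟨ reduce-· d∣n X (pow X k) ⟩
    reduce d X · reduce d (pow X k)         ≡⟨ cong (reduce d X ·_) (reduce-pow X k) ⟩
    reduce d X · pow (reduce d X) k         ≡⟨ pow-suc (reduce d X) k ⟨
    pow (reduce d X) (suc k)                ∎
    where open ≡-Reasoning

  reduce-·₄ : ∀ (A B C D : Mat n) {a b c e} →
    reduce d A ≡ a → reduce d B ≡ b → reduce d C ≡ c → reduce d D ≡ e → reduce d (A · B · C · D) ≡ a · b · c · e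
  reduce-·₄ A B C D refl refl refl refl = begin
    reduce d (A · B · C · D)                          ≡⟨ reduce-· d∣n (A · B · C) D ⟩
    reduce d (A · B · C) · reduce d D                 ≡⟨ cong (_· reduce d D) (reduce-· d∣n (A · B) C) ⟩
    reduce d (A · B) · reduce d C · reduce d D        ≡⟨ cong (λ X → X · reduce d C · reduce d D) (reduce-· d∣n A B) ⟩
    reduce d A · reduce d B · reduce d C · reduce d D ∎
    where open ≡-Reasoning

  reduce-comm-step : ∀ {A A′ B B′ X : Mat n} {a a′ b b′ x} →
    reduce d A ≡ a → reduce d B ≡ b → reduce d A′ ≡ a′ → reduce d B′ ≡ b′ → reduce d X ≡ x →
    reduce d (A · B · A′ · B′ · X) ≡ a · b · a′ · b′ · x
  reduce-comm-step {A} {A′} {B} {B′} {X} A≡ B≡ A′≡ B′≡ X≡ =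
    trans (reduce-· d∣n (A · B · A′ · B′) X) (cong₂ _·_ (reduce-·₄ A B A′ B′ A≡ B≡ A′≡ B′≡) X≡)

  at-·-reduce-inverse : ∀ (P : GL₂Ẑ) (P′ : Mat n) → at P n · P′ ≡ I → at P d · reduce d P′ ≡ I
  at-·-reduce-inverse P P′ PP′≡I =
    subst (λ A → A · reduce d P′ ≡ I) (compat P d n d∣n) (reduce-inverse d∣n (at P n) P′ PP′≡I)

  module _ {H : ZSet} where

    img-reduce : ∀ {A} → img H n A → img H d (reduce d A)
    img-reduce (P , hP , refl) = P , hP , sym (compat P d n d∣n)

    Comm-reduce : ∀ {X} → Comm (img H n) X → Comm (img H d) (reduce d X)
    Comm-reduce comm-one = subst (Comm (img H d)) (sym (reduce-I d∣n)) comm-one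
    Comm-reduce (comm-step sA sB hA hB cX) =
      subst (Comm (img H d)) (sym (reduce-comm-step refl refl refl refl refl))
        (comm-step (img-reduce sA) (img-reduce sB) (reduce-inverse d∣n _ _ hA) (reduce-inverse d∣n _ _ hB)
                   (Comm-reduce cX))

    Comm-lift : ∀ {x} → Comm (img H d) x → ∃ λ X → Comm (img H n) X × reduce d X ≡ x
    Comm-lift comm-one = I , comm-one , reduce-I d∣n
    Comm-lift (comm-step (P , hP , refl) (Q , hQ , refl) ha hb cx) =
      let X , cX , X≡x = Comm-lift cx
          P′ , PP′≡I   = InGL₂⇒inverse (at P n) (invert P n)
          Q′ , QQ′≡I   = InGL₂⇒inverse (at Q n) (invert Q n)
      in  at P n · at Q n · P′ · Q′ · X ,
          comm-step (P , hP , refl) (Q , hQ , refl) PP′≡I QQ′≡I cX ,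
          reduce-comm-step (compat P d n d∣n) (compat Q d n d∣n)
            (reduce-inverse-unique d∣n (at P n) P′ (compat P d n d∣n) PP′≡I ha)
            (reduce-inverse-unique d∣n (at Q n) Q′ (compat Q d n d∣n) QQ′≡I hb) X≡x

-- Conjugation

module _ {n : ℕ} .{{_ : NonZero n}} where
  open import Algebra.Solver.Monoid (·-monoid {n}) using (solve; _⊕_; _⊜_)

  pow-inverse : ∀ {g g′ : Mat n} → g′ · g ≡ I → ∀ k → pow g′ k · pow g k ≡ I
  pow-inverse {g} {g′} g′g≡I zero = trans (cong₂ _·_ (pow-zero g′) (pow-zero g)) (·-identityˡ I)
  pow-inverse {g} {g′} g′g≡I (suc k) = begin
    pow g′ (suc k) · pow g (suc k)      ≡⟨ cong₂ _·_ (pow-sucʳ g′ k) (pow-suc g k) ⟩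
    pow g′ k · g′ · (g · pow g k)       ≡⟨ solve 4 (λ p g′ g q → (p ⊕ g′) ⊕ (g ⊕ q) ⊜ (p ⊕ (g′ ⊕ g)) ⊕ q)
                                             refl (pow g′ k) g′ g (pow g k) ⟩
    pow g′ k · (g′ · g) · pow g k       ≡⟨ cong (λ e → pow g′ k · e · pow g k) g′g≡I ⟩
    pow g′ k · I · pow g k              ≡⟨ cong (_· pow g k) (·-identityʳ (pow g′ k)) ⟩
    pow g′ k · pow g k                  ≡⟨ pow-inverse g′g≡I k ⟩
    I                                   ∎
    where open ≡-Reasoning

  module _ (g g′ : Mat n) (gg′≡I : g · g′ ≡ I) where

    conj : Mat n → Mat n
    conj M = g · M · g′

    private
      g′g≡I : g′ · g ≡ I
      g′g≡I = ·-inverseʳ⇒ˡ g g′ gg′≡I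

      cancel : ∀ h h′ → h · h′ ≡ I → ∀ M → h · (h′ · M · h) · h′ ≡ M
      cancel h h′ hh′≡I M = begin
        h · (h′ · M · h) · h′       ≡⟨ solve 3 (λ h h′ M → (h ⊕ ((h′ ⊕ M) ⊕ h)) ⊕ h′ ⊜ ((h ⊕ h′) ⊕ M) ⊕ (h ⊕ h′))
                                             refl h h′ M ⟩
        (h · h′) · M · (h · h′)     ≡⟨ cong₂ (λ e e′ → e · M · e′) hh′≡I hh′≡I ⟩
        I · M · I                   ≡⟨ trans (·-identityʳ (I · M)) (·-identityˡ M) ⟩
        M                           ∎
        where open ≡-Reasoning

    conj-· : ∀ M N → conj (M · N) ≡ conj M · conj N
    conj-· M N = begin
      g · (M · N) · g′                ≡⟨ cong (λ e → g · (M · e) · g′) (·-identityˡ N) ⟨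
      g · (M · (I · N)) · g′          ≡⟨ cong (λ e → g · (M · (e · N)) · g′) g′g≡I ⟨
      g · (M · (g′ · g · N)) · g′     ≡⟨ solve 4 (λ g M g′ N →
                                           (g ⊕ (M ⊕ ((g′ ⊕ g) ⊕ N))) ⊕ g′ ⊜ ((g ⊕ M) ⊕ g′) ⊕ ((g ⊕ N) ⊕ g′))
                                           refl g M g′ N ⟩
      g · M · g′ · (g · N · g′)       ∎
      where open ≡-Reasoning

    conj-unconj : ∀ M → conj (g′ · M · g) ≡ M
    conj-unconj = cancel g g′ gg′≡I

    unconj-conj : ∀ M → g′ · conj M · g ≡ M
    unconj-conj = cancel g′ g g′g≡I

    unconj-inverse : ∀ {Y A A′} → A ≡ conj Y → A · A′ ≡ I → Y · (g′ · A′ · g) ≡ I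
    unconj-inverse {Y} {A} {A′} refl AA′≡I = begin
      Y · (g′ · A′ · g)               ≡⟨ unconj-conj _ ⟨
      g′ · conj (Y · (g′ · A′ · g)) · g ≡⟨ cong (λ e → g′ · e · g) (conj-· Y (g′ · A′ · g)) ⟩
      g′ · (A · conj (g′ · A′ · g)) · g ≡⟨ cong (λ e → g′ · (A · e) · g) (conj-unconj A′) ⟩
      g′ · (A · A′) · g               ≡⟨ cong (λ e → g′ · e · g) AA′≡I ⟩
      g′ · I · g                      ≡⟨ trans (cong (_· g) (·-identityʳ g′)) g′g≡I ⟩
      I                               ∎
      where open ≡-Reasoning

    Comm-Conj⇒conj : ∀ {K : MSet {n}} {Z} → Comm (Conj g g′ K) Z → ∃ λ Y → Comm K Y × Z ≡ conj Y
    Comm-Conj⇒conj comm-one = I , comm-one , sym (trans (cong (_· g′) (·-identityʳ g)) gg′≡I)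
    Comm-Conj⇒conj (comm-step {A} {A′} {B} {B′} {X} (YA , kA , A≡) (YB , kB , B≡) hA hB cX) =
      let YX , cYX , X≡ = Comm-Conj⇒conj cX
      in  YA · YB · YA′ · YB′ · YX ,
          comm-step kA kB (unconj-inverse A≡ hA) (unconj-inverse B≡ hB) cYX ,
          conj-comm-step X≡
      where
      open ≡-Reasoning
      YA′ = g′ · A′ · g
      YB′ = g′ · B′ · g
      conj-comm-step : ∀ {YX} → X ≡ conj YX → A · B · A′ · B′ · X ≡ conj (YA · YB · YA′ · YB′ · YX)
      conj-comm-step {YX} refl = sym (begin
        conj (YA · YB · YA′ · YB′ · YX)                   ≡⟨ conj-·₅ ⟩
        conj YA · conj YB · conj YA′ · conj YB′ · conj YX ≡⟨ cong₂ (λ a b → a · b · conj YA′ · conj YB′ · conj YX)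
                                                                    (sym A≡) (sym B≡) ⟩
        A · B · conj YA′ · conj YB′ · conj YX             ≡⟨ cong₂ (λ a b → A · B · a · b · conj YX)
                                                                    (conj-unconj A′) (conj-unconj B′) ⟩
        A · B · A′ · B′ · conj YX                         ∎)
        where
        conj-·₅ : conj (YA · YB · YA′ · YB′ · YX) ≡ conj YA · conj YB · conj YA′ · conj YB′ · conj YX
        conj-·₅ = trans (conj-· _ YX) (cong (_· conj YX) (trans (conj-· _ YB′) (cong (_· conj YB′)
                    (trans (conj-· _ YA′) (cong (_· conj YA′) (conj-· YA YB))))))

    -- Comm K is closed under Y ↦ g′ · Y · g; since g′ = g^N and g = g′^N, iterating this N times
    -- gives closure under Y ↦ g · Y · g′.
    Comm-Conj≐⇒Comm-⊇ : ∀ {K G : MSet {n}} (N : ℕ) → pow g (suc N) ≡ I →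
                        Comm K ⊆ₘ Comm G → Comm (Conj g g′ K) ≐ Comm G → Comm G ⊆ₘ Comm K
    Comm-Conj≐⇒Comm-⊇ {K} {G} N gᴺ⁺¹≡I K⊆G K^g≐G X cX =
      let Y , cY , X≡ = Comm-Conj⇒conj (Equivalence.from (K^g≐G X) cX)
      in  subst (Comm K) (trans (cong₂ (λ h h′ → h · Y · h′) g′ᴺ≡g gᴺ≡g′) (sym X≡)) (iterate cY N)
      where
      unconj-closed : ∀ {Y} → Comm K Y → Comm K (g′ · Y · g)
      unconj-closed {Y} cY =
        let Y₁ , cY₁ , Y≡ = Comm-Conj⇒conj (Equivalence.from (K^g≐G Y) (K⊆G Y cY))
        in  subst (Comm K) (trans (sym (unconj-conj Y₁)) (cong (λ e → g′ · e · g) (sym Y≡))) cY₁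
      iterate : ∀ {Y} → Comm K Y → ∀ k → Comm K (pow g′ k · Y · pow g k)
      iterate {Y} cY zero    = subst (Comm K) (sym (trans (cong₂ (λ h h′ → h · Y · h′) (pow-zero g′) (pow-zero g))
                                                         (trans (·-identityʳ (I · Y)) (·-identityˡ Y)))) cY
      iterate {Y} cY (suc k) = subst (Comm K) (begin
        g′ · (pow g′ k · Y · pow g k) · g      ≡⟨ solve 5 (λ g′ p Y q g →
                                                    (g′ ⊕ ((p ⊕ Y) ⊕ q)) ⊕ g ⊜ ((g′ ⊕ p) ⊕ Y) ⊕ (q ⊕ g))
                                                    refl g′ (pow g′ k) Y (pow g k) g ⟩
        g′ · pow g′ k · Y · (pow g k · g)      ≡⟨ cong₂ (λ h h′ → h · Y · h′) (pow-suc g′ k) (pow-sucʳ g k) ⟨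
        pow g′ (suc k) · Y · pow g (suc k)     ∎) (unconj-closed (iterate cY k))
        where open ≡-Reasoning
      gᴺ≡g′ : pow g N ≡ g′
      gᴺ≡g′ = inverse-unique g (pow g N) g′ (trans (sym (pow-suc g N)) gᴺ⁺¹≡I) gg′≡I
      g′ᴺ≡g : pow g′ N ≡ g
      g′ᴺ≡g = inverse-unique g′ (pow g′ N) g
        (·-inverseʳ⇒ˡ (pow g′ N) g′ (subst (λ h → pow g′ N · h ≡ I) gᴺ≡g′ (pow-inverse g′g≡I N))) g′g≡I

Conj-I : ∀ {n} .{{_ : NonZero n}} (K : MSet {n}) M → Conj I I K M ⇔ K M
Conj-I K M = mk⇔ (λ { (Y , kY , M≡) → subst K (sym (trans M≡ (IYI Y))) kY }) (λ kM → M , kM , sym (IYI M))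
  where
  IYI : ∀ Y → I · Y · I ≡ Y
  IYI Y = trans (·-identityʳ (I · Y)) (·-identityˡ Y)

upperẐ lowerẐ : ℕ → GL₂Ẑ
upperẐ m = record
  { at = λ n → upper (m mod n) ; compat = λ d n d∣n → reduce-upper d∣n m
  ; invert = λ n → det≡1⇒InGL₂ (upper (m mod n)) (det-upper (m mod n)) }
lowerẐ m = record
  { at = λ n → lower (m mod n) ; compat = λ d n d∣n → reduce-lower d∣n m
  ; invert = λ n → det≡1⇒InGL₂ (lower (m mod n)) (det-lower (m mod n)) }

reflectionẐ : GL₂Ẑ
reflectionẐ = record
  { at = λ n → reflection ; compat = λ d n d∣n → reduce-reflection d∣n
  ; invert = λ n → det reflection , det-inverse reflection reflection reflection-involutive }

level2-I : ∀ t → level2 t I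
level2-I 2Cs = refl
level2-I 2B  = inj₁ refl
level2-I 2Cn = inj₁ refl

-- Finite computations

infix 4 _≟ₘ_
_≟ₘ_ : ∀ {n} → DecidableEquality (Mat n)
mat a b c d ≟ₘ mat a′ b′ c′ d′ =
  map′ (λ { (refl , refl , refl , refl) → refl }) (λ { refl → refl , refl , refl , refl })
       (a ≟ a′ ×-dec b ≟ b′ ×-dec c ≟ c′ ×-dec d ≟ d′)

allMat? : ∀ {n} {P : Mat n → Set} → (∀ M → Dec (P M)) → Dec (∀ M → P M)
allMat? P? = map′ (λ ∀abcd → λ { (mat a b c d) → ∀abcd a b c d }) (λ ∀M a b c d → ∀M (mat a b c d))
                  (all? λ a → all? λ b → all? λ c → all? λ d → P? (mat a b c d))

isUnit? : ∀ {n} .{{_ : NonZero n}} (u : Fin n) → Dec (IsUnit u)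
isUnit? u = any? λ v → u *ₙ v ≟ 1ₙ

level2? : ∀ t M → Dec (level2 t M)
level2? 2Cs M = M ≟ₘ I
level2? 2B  M = M ≟ₘ I ⊎-dec M ≟ₘ mat (# 1) (# 1) (# 0) (# 1)
level2? 2Cn M = M ≟ₘ I ⊎-dec (M ≟ₘ mat (# 0) (# 1) (# 1) (# 1) ⊎-dec M ≟ₘ mat (# 1) (# 1) (# 1) (# 0))

level2-abelian : ∀ t (A B : Mat 2) → level2 t A → level2 t B → A · B ≡ B · A
level2-abelian 2Cs = from-yes (allMat? λ A → allMat? λ B → level2? 2Cs A →-dec (level2? 2Cs B →-dec A · B ≟ₘ B · A))
level2-abelian 2B  = from-yes (allMat? λ A → allMat? λ B → level2? 2B A →-dec (level2? 2B B →-dec A · B ≟ₘ B · A))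
level2-abelian 2Cn = from-yes (allMat? λ A → allMat? λ B → level2? 2Cn A →-dec (level2? 2Cn B →-dec A · B ≟ₘ B · A))

private
  inverse₉ : Fin 9 → Fin 9
  inverse₉ x with toℕ x
  ... | 1 = # 1
  ... | 2 = # 5
  ... | 4 = # 7
  ... | 5 = # 2
  ... | 7 = # 4
  ... | 8 = # 8
  ... | _ = # 0

  -- If c is a unit, (a b; c d) = U((a−1)/c) L(c) U((d−1)/c) when the determinant is 1;
  -- otherwise a + c is a unit and this applies to L(1)·(a b; c d).
  unipotentFactors : Mat 9 → Fin 9 × Fin 9 × Fin 9 × Fin 9
  unipotentFactors (mat a b c d) with does (isUnit? c)
  ... | true  = # 0 , (a -ₙ # 1) *ₙ inverse₉ c , c , (d -ₙ # 1) *ₙ inverse₉ c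
  ... | false = # 8 , (a -ₙ # 1) *ₙ inverse₉ (a +ₙ c) , a +ₙ c , (b +ₙ d -ₙ # 1) *ₙ inverse₉ (a +ₙ c)

SL₂[9]-unipotentWord : ∀ (M : Mat 9) → det M ≡ 1ₙ → ∃ λ w → M ≡ unipotentWord w
SL₂[9]-unipotentWord M det≡1 = unipotentFactors M , factorization M det≡1
  where
  factorization : ∀ (M : Mat 9) → det M ≡ 1ₙ → M ≡ unipotentWord (unipotentFactors M)
  factorization = from-yes (allMat? λ M → det M ≟ 1ₙ →-dec M ≟ₘ unipotentWord (unipotentFactors M))

-- The Chinese remainder map ℤ/2^k × ℤ/9 → ℤ/m₀: 9 ≡ 1 (mod 2^k), and crt-β t ≡ 0 (mod 2^k), ≡ 1 (mod 9).
crt-β : Label → ℕ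
crt-β 2Cs = 64
crt-β 2B  = 28
crt-β 2Cn = 28

crt : ∀ t → Fin (2^k t) → Fin 9 → Fin (m₀ t)
crt t a b = (toℕ a * 9 + toℕ b * crt-β t) mod m₀ t

red-crt-2^k : ∀ t a b → red (2^k t) (crt t a b) ≡ a
red-crt-2^k 2Cs = from-yes (all? λ a → all? λ b → red (2^k 2Cs) (crt 2Cs a b) ≟ a)
red-crt-2^k 2B  = from-yes (all? λ a → all? λ b → red (2^k 2B) (crt 2B a b) ≟ a)
red-crt-2^k 2Cn = from-yes (all? λ a → all? λ b → red (2^k 2Cn) (crt 2Cn a b) ≟ a)

red-crt-9 : ∀ t a b → red 9 (crt t a b) ≡ b
red-crt-9 2Cs = from-yes (all? λ a → all? λ b → red 9 (crt 2Cs a b) ≟ b)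
red-crt-9 2B  = from-yes (all? λ a → all? λ b → red 9 (crt 2B a b) ≟ b)
red-crt-9 2Cn = from-yes (all? λ a → all? λ b → red 9 (crt 2Cn a b) ≟ b)

crt-red : ∀ t x → crt t (red (2^k t) x) (red 9 x) ≡ x
crt-red 2Cs = from-yes (all? λ x → crt 2Cs (red (2^k 2Cs) x) (red 9 x) ≟ x)
crt-red 2B  = from-yes (all? λ x → crt 2B (red (2^k 2B) x) (red 9 x) ≟ x)
crt-red 2Cn = from-yes (all? λ x → crt 2Cn (red (2^k 2Cn) x) (red 9 x) ≟ x)

opaque
  unfolding pow

  kernel-mod-2-exponent-4 : ∀ t (M : Mat (2^k t)) → reduce 2 M ≡ I → pow M 4 ≡ I
  kernel-mod-2-exponent-4 2Cs = from-yes (allMat? λ (M : Mat (2^k 2Cs)) → reduce 2 M ≟ₘ I →-dec pow M 4 ≟ₘ I)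
  kernel-mod-2-exponent-4 2B  = from-yes (allMat? λ (M : Mat (2^k 2B)) → reduce 2 M ≟ₘ I →-dec pow M 4 ≟ₘ I)
  kernel-mod-2-exponent-4 2Cn = from-yes (allMat? λ (M : Mat (2^k 2Cn)) → reduce 2 M ≟ₘ I →-dec pow M 4 ≟ₘ I)

  GL₂-exponent-24 : ∀ t (M : Mat (2^k t)) → InGL₂ M → pow M 24 ≡ I
  GL₂-exponent-24 2Cs = from-yes (allMat? λ (M : Mat (2^k 2Cs)) → isUnit? (det M) →-dec pow M 24 ≟ₘ I)
  GL₂-exponent-24 2B  = from-yes (allMat? λ (M : Mat (2^k 2B)) → isUnit? (det M) →-dec pow M 24 ≟ₘ I)
  GL₂-exponent-24 2Cn = from-yes (allMat? λ (M : Mat (2^k 2Cn)) → isUnit? (det M) →-dec pow M 24 ≟ₘ I)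

  pow-upper₉ : ∀ (x : Fin 9) → pow (upper 1ₙ) (toℕ x) ≡ upper x
  pow-upper₉ = from-yes (all? λ (x : Fin 9) → pow (upper 1ₙ) (toℕ x) ≟ₘ upper x)

  pow-lower₉ : ∀ (x : Fin 9) → pow (lower 1ₙ) (toℕ x) ≡ lower x
  pow-lower₉ = from-yes (all? λ (x : Fin 9) → pow (lower 1ₙ) (toℕ x) ≟ₘ lower x)

  -- [D, U(4)] = U(1) where D = diag(−1, 1), and 28 ≡ 1 (mod 9) while 4 ∣ 28.
  upper-commutator-pow-28 : pow (reflection · upper (# 4) · reflection · upper (# 5)) 28 ≡ upper {9} (# 1)
  upper-commutator-pow-28 = refl

  lower-commutator-pow-28 : pow (reflection · lower (# 4) · reflection · lower (# 5)) 28 ≡ lower {9} (# 1)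
  lower-commutator-pow-28 = refl

-- The level m₀ = 2^k · 9

2^k∣m₀ : ∀ t → 2^k t ∣ m₀ t
2^k∣m₀ 2Cs = divides 9 refl
2^k∣m₀ 2B  = divides 9 refl
2^k∣m₀ 2Cn = divides 9 refl

9∣m₀ : ∀ t → 9 ∣ m₀ t
9∣m₀ 2Cs = divides 8 refl
9∣m₀ 2B  = divides 4 refl
9∣m₀ 2Cn = divides 4 refl

2∣2^k : ∀ t → 2 ∣ 2^k t
2∣2^k 2Cs = divides 4 refl
2∣2^k 2B  = divides 2 refl
2∣2^k 2Cn = divides 2 refl

2∣m₀ : ∀ t → 2 ∣ m₀ t
2∣m₀ t = ∣-trans (2∣2^k t) (2^k∣m₀ t)

module _ (t : Label) where

  red-injective : ∀ {x y : Fin (m₀ t)} → red (2^k t) x ≡ red (2^k t) y → red 9 x ≡ red 9 y → x ≡ y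
  red-injective {x} {y} x≡y-mod-2^k x≡y-mod-9 =
    trans (sym (crt-red t x)) (trans (cong₂ (crt t) x≡y-mod-2^k x≡y-mod-9) (crt-red t y))

  reduce-injective : ∀ {X Y : Mat (m₀ t)} → reduce (2^k t) X ≡ reduce (2^k t) Y → reduce 9 X ≡ reduce 9 Y → X ≡ Y
  reduce-injective {mat a b c d} {mat a′ b′ c′ d′} X≡Y-mod-2^k X≡Y-mod-9 = mat-≡
    (red-injective (cong Mat.a X≡Y-mod-2^k) (cong Mat.a X≡Y-mod-9))
    (red-injective (cong Mat.b X≡Y-mod-2^k) (cong Mat.b X≡Y-mod-9))
    (red-injective (cong Mat.c X≡Y-mod-2^k) (cong Mat.c X≡Y-mod-9))
    (red-injective (cong Mat.d X≡Y-mod-2^k) (cong Mat.d X≡Y-mod-9))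

  crtₘ : Mat (2^k t) → Mat 9 → Mat (m₀ t)
  crtₘ (mat a b c d) (mat a′ b′ c′ d′) = mat (crt t a a′) (crt t b b′) (crt t c c′) (crt t d d′)

  reduce-crtₘ-2^k : ∀ A B → reduce (2^k t) (crtₘ A B) ≡ A
  reduce-crtₘ-2^k (mat a b c d) (mat a′ b′ c′ d′) =
    mat-≡ (red-crt-2^k t a a′) (red-crt-2^k t b b′) (red-crt-2^k t c c′) (red-crt-2^k t d d′)

  reduce-crtₘ-9 : ∀ A B → reduce 9 (crtₘ A B) ≡ B
  reduce-crtₘ-9 (mat a b c d) (mat a′ b′ c′ d′) =
    mat-≡ (red-crt-9 t a a′) (red-crt-9 t b b′) (red-crt-9 t c c′) (red-crt-9 t d d′)

  crt-unit : ∀ a b → IsUnit a → IsUnit b → IsUnit (crt t a b)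
  crt-unit a b (a′ , aa′≡1) (b′ , bb′≡1) =
    crt t a′ b′ , red-injective {x = crt t a b *ₙ crt t a′ b′} {y = 1ₙ}
    (trans (red-*ₙ (2^k∣m₀ t) (crt t a b) (crt t a′ b′)) (trans (cong₂ _*ₙ_ (red-crt-2^k t a b) (red-crt-2^k t a′ b′))
      (trans aa′≡1 (sym (red-1ₙ (2^k∣m₀ t))))))
    (trans (red-*ₙ (9∣m₀ t) (crt t a b) (crt t a′ b′)) (trans (cong₂ _*ₙ_ (red-crt-9 t a b) (red-crt-9 t a′ b′))
      (trans bb′≡1 (sym (red-1ₙ (9∣m₀ t))))))

  module _ {S : ZSet} (S⊆G : S ⊆ᶻ Ĝ t) where

    commutator-pow-28 : ∀ {a b : GL₂Ẑ} {B B′ : Mat 9} → S a → S b →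
      at a 9 ≡ reflection → at b 9 ≡ B → B · B′ ≡ I →
      ∃ λ E → Comm (img S (m₀ t)) E × reduce (2^k t) E ≡ I × reduce 9 E ≡ pow (reflection · B · reflection · B′) 28
    commutator-pow-28 {a} {b} {B} {B′} sa sb a≡ b≡ BB′≡I =
      let A′ , AA′≡I = InGL₂⇒inverse (at a (m₀ t)) (invert a (m₀ t))
          C′ , CC′≡I = InGL₂⇒inverse (at b (m₀ t)) (invert b (m₀ t))
          c = at a (m₀ t) · at b (m₀ t) · A′ · C′
          c≡I-mod-2 : reduce 2 (reduce (2^k t) c) ≡ I
          c≡I-mod-2 = trans (reduce-reduce (2∣2^k t) c)
            (trans (reduce-·₄ (2∣m₀ t) (at a (m₀ t)) (at b (m₀ t)) A′ C′
                      (compat a 2 (m₀ t) (2∣m₀ t)) (compat b 2 (m₀ t) (2∣m₀ t)) refl refl)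
                   (commuting⇒commutator≡I (at a 2) (at b 2) _ _ (level2-abelian t _ _ (S⊆G a sa) (S⊆G b sb))
                      (at-·-reduce-inverse (2∣m₀ t) a A′ AA′≡I) (at-·-reduce-inverse (2∣m₀ t) b C′ CC′≡I)))
          a≡mod-9 = trans (compat a 9 (m₀ t) (9∣m₀ t)) a≡
          b≡mod-9 = trans (compat b 9 (m₀ t) (9∣m₀ t)) b≡
      in  pow c 28 ,
          Comm-pow (Comm-commutator {A′ = A′} {B′ = C′} (a , sa , refl) (b , sb , refl) AA′≡I CC′≡I) 28 ,
          trans (reduce-pow (2^k∣m₀ t) c 28)
                (pow-*-≡I (reduce (2^k t) c) 4 (kernel-mod-2-exponent-4 t (reduce (2^k t) c) c≡I-mod-2) 7) ,
          trans (reduce-pow (9∣m₀ t) c 28) (cong (λ X → pow X 28)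
            (reduce-·₄ (9∣m₀ t) (at a (m₀ t)) (at b (m₀ t)) A′ C′ a≡mod-9 b≡mod-9
              (reduce-inverse-unique (9∣m₀ t) (at a (m₀ t)) A′ a≡mod-9 AA′≡I refl)
              (reduce-inverse-unique (9∣m₀ t) (at b (m₀ t)) C′ b≡mod-9 CC′≡I BB′≡I)))

    unipotentWord⊆Comm : ∀ {Eu El} → Comm (img S (m₀ t)) Eu → Comm (img S (m₀ t)) El →
      reduce (2^k t) Eu ≡ I → reduce (2^k t) El ≡ I → reduce 9 Eu ≡ upper 1ₙ → reduce 9 El ≡ lower 1ₙ →
      ∀ w → ∃ λ W → Comm (img S (m₀ t)) W × reduce (2^k t) W ≡ I × reduce 9 W ≡ unipotentWord w
    unipotentWord⊆Comm {Eu} {El} cEu cEl Eu≡I El≡I Eu≡U El≡L (w , x , y , z) =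
      Lʷ · Uˣ · Lʸ · Uᶻ ,
      Comm-· (Comm-· (Comm-· (Comm-pow cEl (toℕ w)) (Comm-pow cEu (toℕ x))) (Comm-pow cEl (toℕ y))) (Comm-pow cEu (toℕ z)) ,
      trans (reduce-·₄ (2^k∣m₀ t) Lʷ Uˣ Lʸ Uᶻ (pow≡I El El≡I (toℕ w)) (pow≡I Eu Eu≡I (toℕ x))
                                              (pow≡I El El≡I (toℕ y)) (pow≡I Eu Eu≡I (toℕ z)))
            (trans (cong (λ X → X · I · I) (·-identityˡ I)) (trans (cong (_· I) (·-identityˡ I)) (·-identityˡ I))) ,
      reduce-·₄ (9∣m₀ t) Lʷ Uˣ Lʸ Uᶻ (pow-mod-9 El El≡L (pow-lower₉ w)) (pow-mod-9 Eu Eu≡U (pow-upper₉ x))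
                                     (pow-mod-9 El El≡L (pow-lower₉ y)) (pow-mod-9 Eu Eu≡U (pow-upper₉ z))
      where
      Lʷ = pow El (toℕ w)
      Uˣ = pow Eu (toℕ x)
      Lʸ = pow El (toℕ y)
      Uᶻ = pow Eu (toℕ z)
      pow≡I : ∀ E → reduce (2^k t) E ≡ I → ∀ k → reduce (2^k t) (pow E k) ≡ I
      pow≡I E E≡I k = trans (reduce-pow (2^k∣m₀ t) E k) (trans (cong (λ X → pow X k) E≡I) (pow-I k))
      pow-mod-9 : ∀ E {G : Mat 9} {k G′} → reduce 9 E ≡ G → pow G k ≡ G′ → reduce 9 (pow E k) ≡ G′
      pow-mod-9 E {k = k} E≡G Gᵏ≡G′ = trans (reduce-pow (9∣m₀ t) E k) (trans (cong (λ X → pow X k) E≡G) Gᵏ≡G′)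

    SL₂[9]-part⊆Comm : ∀ {a u l} → S a → S u → S l →
      at a 9 ≡ reflection → at u 9 ≡ upper (# 4) → at l 9 ≡ lower (# 4) →
      ∀ Y → reduce (2^k t) Y ≡ I → det (reduce 9 Y) ≡ 1ₙ → Comm (img S (m₀ t)) Y
    SL₂[9]-part⊆Comm sa su sl a≡ u≡ l≡ Y Y≡I det≡1 =
      let Eu , cEu , Eu≡I , Eu≡ = commutator-pow-28 {B′ = upper (# 5)} sa su a≡ u≡ refl
          El , cEl , El≡I , El≡ = commutator-pow-28 {B′ = lower (# 5)} sa sl a≡ l≡ refl
          w , Y≡w = SL₂[9]-unipotentWord (reduce 9 Y) det≡1
          W , cW , W≡I , W≡w = unipotentWord⊆Comm cEu cEl Eu≡I El≡I
                                 (trans Eu≡ upper-commutator-pow-28) (trans El≡ lower-commutator-pow-28) w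
      in  subst (Comm (img S (m₀ t))) (reduce-injective (trans W≡I (sym Y≡I)) (trans W≡w (sym Y≡w))) cW

module Criterion (t : Label) {H : ZSet} (H-subgroup : IsSubgroup H) (H⊆G : H ⊆ᶻ Ĝ t)
                 (det-surjective : ∀ u → detImage (img H (m₀ t)) u ⇔ IsUnit u) where

  private
    q = 2^k t
    m = m₀ t

  img-H⊆img-G : ∀ {n} .{{_ : NonZero n}} → img H n ⊆ₘ img (Ĝ t) n
  img-H⊆img-G M (P , hP , P≡M) = P , H⊆G P hP , P≡M

  det-reduce-surjective : ∀ {d} .{{_ : NonZero d}} → d ∣ m →
                          ∀ (w : Fin m) → IsUnit w → ∃ λ P → H P × det (at P d) ≡ red d w
  det-reduce-surjective {d} d∣m w w-unit =
    let M , (P , hP , P≡M) , detM≡w = Equivalence.from (det-surjective w) w-unit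
    in  P , hP , (begin
          det (at P d)                ≡⟨ cong det (compat P d m d∣m) ⟨
          det (reduce d (at P m))     ≡⟨ det-reduce d∣m (at P m) ⟩
          red d (det (at P m))        ≡⟨ cong (λ X → red d (det X)) P≡M ⟩
          red d (det M)               ≡⟨ cong (red d) detM≡w ⟩
          red d w                     ∎)
    where open ≡-Reasoning

  SL₂[9]-part⊆Comm-G : ∀ Y → reduce q Y ≡ I → det (reduce 9 Y) ≡ 1ₙ → Comm (img (Ĝ t) m) Y
  SL₂[9]-part⊆Comm-G = SL₂[9]-part⊆Comm t (λ _ g → g)
    {a = reflectionẐ} {u = upperẐ 4} {l = lowerẐ 4} (level2-I t) (level2-I t) (level2-I t) refl refl refl

  module _ (Comm≐ : Comm (img H m) ≐ Comm (img (Ĝ t) m)) where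

    -- M = N · P(9), where P ∈ H has det P(9) = det M and N ∈ SL₂(ℤ/9) is the 9-part of an
    -- element of [G(m₀), G(m₀)] = [H(m₀), H(m₀)].
    Comm≐⇒GL₂[9]⊆img : ∀ M → InGL₂ M → img H 9 M
    Comm≐⇒GL₂[9]⊆img M M-invertible =
      let P , hP , detP≡ = det-reduce-surjective (9∣m₀ t) (crt t 1ₙ (det M))
                             (crt-unit t 1ₙ (det M) 1ₙ-unit M-invertible)
          P′ , hP′ , PP′≡I = IsSubgroup.has-inv H-subgroup P hP
          N = M · at P′ 9
          detN≡1 : det N ≡ 1ₙ
          detN≡1 = trans (det-· M (at P′ 9)) (trans (cong (_*ₙ det (at P′ 9))
                     (sym (trans detP≡ (red-crt-9 t 1ₙ (det M))))) (det-inverse (at P 9) (at P′ 9) (PP′≡I 9)))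
          Y = crtₘ t I N
          cY = Equivalence.from (Comm≐ Y) (SL₂[9]-part⊆Comm-G Y (reduce-crtₘ-2^k t I N)
                 (trans (cong det (reduce-crtₘ-9 t I N)) detN≡1))
          N∈H₉ = subst (img H 9) (reduce-crtₘ-9 t I N) (Comm-img⊆img H-subgroup _ (Comm-reduce (9∣m₀ t) cY))
      in  subst (img H 9) (begin
            M · at P′ 9 · at P 9     ≡⟨ ·-assoc M (at P′ 9) (at P 9) ⟩
            M · (at P′ 9 · at P 9)   ≡⟨ cong (M ·_) (·-inverseʳ⇒ˡ (at P 9) (at P′ 9) (PP′≡I 9)) ⟩
            M · I                    ≡⟨ ·-identityʳ M ⟩
            M                        ∎)
          (img-· H-subgroup N∈H₉ (P , hP , refl))
      where open ≡-Reasoning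

    Comm≐⇒In𝓜 : In𝓜 (img H q) (img (Ĝ t) q)
    Comm≐⇒In𝓜 = I , I , ·-identityˡ I , Conj⊆G , det-equal , Comm-equal
      where
      K = img H q
      Conj⊆G : Conj I I K ⊆ₘ img (Ĝ t) q
      Conj⊆G M c = img-H⊆img-G M (Equivalence.to (Conj-I K M) c)
      det-equal : ∀ u → detImage (Conj I I K) u ⇔ detImage (img (Ĝ t) q) u
      det-equal u = mk⇔ (λ { (M , c , detM≡u) → M , Conj⊆G M c , detM≡u }) λ { (M , (P , _ , refl) , detM≡u) →
        let u-unit = subst IsUnit detM≡u (invert P q)
            P′ , hP′ , detP′≡ = det-reduce-surjective (2^k∣m₀ t) (crt t u 1ₙ) (crt-unit t u 1ₙ u-unit 1ₙ-unit)
        in  at P′ q , Equivalence.from (Conj-I K _) (P′ , hP′ , refl) , trans detP′≡ (red-crt-2^k t u 1ₙ) }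
      Comm-equal : Comm (Conj I I K) ≐ Comm (img (Ĝ t) q)
      Comm-equal X = mk⇔ (Comm-mono Conj⊆G X) λ cX →
        let X̃ , cX̃ , X̃≡X = Comm-lift (2^k∣m₀ t) cX
        in  Comm-mono (λ M → Equivalence.from (Conj-I K M)) X
              (subst (Comm K) X̃≡X (Comm-reduce (2^k∣m₀ t) (Equivalence.from (Comm≐ X̃) cX̃)))

  -- X = Z · (Z⁻¹ · X), where Z ∈ [H(m₀), H(m₀)] has the same 2^k-part as X, so that Z⁻¹ · X has
  -- trivial 2^k-part and determinant 1.
  GL₂[9]⊆img×In𝓜⇒Comm≐ : (∀ M → InGL₂ M → img H 9 M) → In𝓜 (img H q) (img (Ĝ t) q) →
                          Comm (img H m) ≐ Comm (img (Ĝ t) m)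
  GL₂[9]⊆img×In𝓜⇒Comm≐ GL₂[9]⊆H₉ (g , g′ , gg′≡I , _ , _ , Comm-Conj≐) X =
    mk⇔ (Comm-mono img-H⊆img-G X) λ cX →
      let x∈Comm-H = Comm-Conj≐⇒Comm-⊇ g g′ gg′≡I 23 (GL₂-exponent-24 t g (det g′ , det-inverse g g′ gg′≡I))
                       (Comm-mono img-H⊆img-G) Comm-Conj≐ (reduce q X) (Comm-reduce (2^k∣m₀ t) cX)
          Z , cZ , Z≡x = Comm-lift (2^k∣m₀ t) x∈Comm-H
          detZ≡1 : det Z ≡ 1ₙ
          detZ≡1 = det-Comm Z cZ
          Z′ , ZZ′≡I = InGL₂⇒inverse Z (det≡1⇒InGL₂ Z detZ≡1)
          V≡I : reduce q (Z′ · X) ≡ I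
          V≡I = trans (reduce-· (2^k∣m₀ t) Z′ X) (trans (cong (reduce q Z′ ·_) (sym Z≡x))
                  (reduce-inverse (2^k∣m₀ t) Z′ Z (·-inverseʳ⇒ˡ Z Z′ ZZ′≡I)))
          detV≡1 : det (reduce 9 (Z′ · X)) ≡ 1ₙ
          detV≡1 = det≡1-reduce (9∣m₀ t) (Z′ · X)
                     (det≡1-· Z′ X (det≡1-inverse Z Z′ detZ≡1 ZZ′≡I) (det-Comm X cX))
          cV : Comm (img H m) (Z′ · X)
          cV = SL₂[9]-part⊆Comm-H (Z′ · X) V≡I detV≡1
          ZV≡X : Z · (Z′ · X) ≡ X
          ZV≡X = inverse-cancelˡ Z Z′ X ZZ′≡I
      in  subst (Comm (img H m)) ZV≡X (Comm-· {X = Z} {Y = Z′ · X} cZ cV)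
    where
    SL₂[9]-part⊆Comm-H : ∀ Y → reduce q Y ≡ I → det (reduce 9 Y) ≡ 1ₙ → Comm (img H m) Y
    SL₂[9]-part⊆Comm-H =
      let _ , ha , a≡ = GL₂[9]⊆H₉ reflection (# 8 , refl)
          _ , hu , u≡ = GL₂[9]⊆H₉ (upper (# 4)) (# 1 , refl)
          _ , hl , l≡ = GL₂[9]⊆H₉ (lower (# 4)) (# 1 , refl)
      in  SL₂[9]-part⊆Comm t H⊆G ha hu hl a≡ u≡ l≡

proposition2p10 : (t : Label) (H : ZSet) → IsSubgroup H → H ⊆ᶻ Ĝ t →
    (∀ (u : Fin (m₀ t)) → detImage (img H (m₀ t)) u ⇔ IsUnit {m₀ t} u) →
    (Comm (img H (m₀ t)) ≐ Comm (img (Ĝ t) (m₀ t))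
      ⇔ ((∀ M → InGL₂ {9} M → img H 9 M) × In𝓜 (img H (2^k t)) (img (Ĝ t) (2^k t))))
proposition2p10 t H H-subgroup H⊆G det-surjective =
  mk⇔ (λ Comm≐ → Comm≐⇒GL₂[9]⊆img Comm≐ , Comm≐⇒In𝓜 Comm≐)
      (λ (GL₂[9]⊆H₉ , H₂ᵏ∈𝓜) → GL₂[9]⊆img×In𝓜⇒Comm≐ GL₂[9]⊆H₉ H₂ᵏ∈𝓜)
  where open Criterion t H-subgroup H⊆G det-surjective
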